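{- For any interval set $I$ there exists an intersecting coloring $C$ of $I$ such that $\mathcal{E}(C)\ge\mathrm{cost}(I)$.
   Context: An interval set is a finite set of nonempty closed intervals of the real line with all start and end points pairwise distinct. For $x=[\ell_x,r_x]\in I$ and $t\in x$, $W_{x,t}=\{[\ell_y,r_y]\in I:\ell_x\le\ell_y\le t\le r_y\}$ and $W_x=W_{x,t^*}$ for an arbitrary $t^*\in x$ maximizing $|W_{x,t}|$; $\mathrm{cost}(I)=\sum_{x\in I}\log|W_x|$. An intersecting coloring with $k$ colors is a map $C:I\to\{1,\dots,k\}$ such that the intervals of each color have nonempty common intersection; with $c_i=|C^{ -1}(i)|$, the energy is $\mathcal{E}(C)=2\sum_{i=1}^k c_i\log c_i$. Logarithms are base 2, with $0\log0=0$.
   Formalization: The endpoints of the intervals, the points t at which $|W_{x,t}|$ is maximized, and the common points of the colour classes are rational rather than real. -}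

module Defs where

open import Data.Nat as ℕ using (ℕ; zero; suc; _^_)
open import Data.Fin using (Fin; zero; suc)
open import Data.Fin.Properties as FinP using ()
open import Data.Rational using (ℚ; _≤_)
open import Data.Rational.Properties using (_≤?_)
open import Data.Sum using (_⊎_; inj₁; inj₂)
open import Data.Product using (_×_; ∃; ∃-syntax; Σ-syntax)
open import Data.List using (List; length; filter)
open import Data.List.Base using (allFin)
open import Relation.Nullary.Decidable using (_×-dec_)
open import Relation.Binary.PropositionalEquality using (_≡_)

-- An interval set with n intervals: interval j is [ℓ j , r j].
-- The list of all 2n endpoints, indexed by Fin n ⊎ Fin n
-- (inj₁ j = start point of j, inj₂ j = end point of j).
endpoint : ∀ {n} → (ℓ r : Fin n → ℚ) → Fin n ⊎ Fin n → ℚ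
endpoint ℓ r (inj₁ j) = ℓ j
endpoint ℓ r (inj₂ j) = r j

cardW : ∀ {n} → (ℓ r : Fin n → ℚ) → Fin n → ℚ → ℕ
cardW {n} ℓ r x t =
  length (filter (λ y → (ℓ x ≤? ℓ y) ×-dec ((ℓ y ≤? t) ×-dec (t ≤? r y))) (allFin n))

IsMaxW : ∀ {n} → (ℓ r : Fin n → ℚ) → (Fin n → ℕ) → Set
IsMaxW ℓ r w = ∀ x →
  (∃[ t ] ((ℓ x ≤ t) × (t ≤ r x)) × cardW ℓ r x t ≡ w x)
  × (∀ t → ℓ x ≤ t → t ≤ r x → cardW ℓ r x t ℕ.≤ w x)

prodFin : ∀ n → (Fin n → ℕ) → ℕ
prodFin zero f = 1
prodFin (suc n) f = f zero ℕ.* prodFin n (λ i → f (suc i))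

colorCount : ∀ {n k} → (Fin n → Fin k) → Fin k → ℕ
colorCount {n} C i = length (filter (λ j → C j FinP.≟ i) (allFin n))

Intersecting : ∀ {n k} → (ℓ r : Fin n → ℚ) → (Fin n → Fin k) → Set
Intersecting {n} {k} ℓ r C =
  ∀ (i : Fin k) → ∃[ p ] (∀ j → C j ≡ i → (ℓ j ≤ p) × (p ≤ r j))

-- Colour greedily: pick a left endpoint p of maximum depth c, give the c intervals
-- through p one colour, and recurse on the others.  To compare with ∏ₓ |Wₓ|, track the
-- potential ∏_{x ∈ T} |Wₓ| in which Wₓ is computed inside the current subfamily T.
-- Deleting one interval y from T changes the potential by a factor of at most c²:
-- y's own factor is at most c, the intervals not containing ℓ y keep their factor, and
-- each of the k other intervals through ℓ y loses at most 1; sorted by left endpoint,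
-- their factors in T − y are at least k, k − 1, …, 1, so together they shrink by at most
-- ∏ (1 + 1/i) = k + 1 ≤ c.  Deleting the whole colour class thus costs (c²)^c = c^(2c),
-- which is its share of the energy.

module Submission where

open import Defs
open import Data.Nat using (ℕ; _^_; _*_) renaming (_≤_ to _≤ℕ_)
open import Data.Fin using (Fin)
open import Data.Rational using (ℚ; _≤_)
open import Data.Product using (_×_; ∃-syntax)
open import Relation.Binary.PropositionalEquality using (_≡_)
open import Function.Definitions using (Injective)

open import Algebra.Bundles using (CommutativeMonoid)
open import Data.Bool using (Bool; true; false; T; _∧_; not; if_then_else_)
open import Data.Bool.Properties using (T?; T-∧; ∧-identityʳ; ∧-zeroʳ; ∧-commutativeMonoid)
open import Data.Empty using (⊥-elim)
open import Data.Fin using (zero; suc; punchIn)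
open import Data.Fin.Properties using (_≟_; any?; punchInᵢ≢i)
open import Data.List using (length; filter; tabulate)
open import Data.Nat using (zero; suc; _+_; _<_; z≤n; s≤s)
open import Data.Nat.Induction using (<-wellFounded)
open import Data.Nat.Properties
  using ( ≤-refl; ≤-reflexive; ≤-trans; m≤n⇒m≤1+n; m≤m⊔n; ⊔-lub; +-mono-≤; +-monoˡ-≤
        ; *-mono-≤; *-monoˡ-≤; *-monoʳ-≤; *-identityˡ; *-identityʳ; *-assoc; *-comm; ^-*-assoc
        ; ≤-totalPreorder; module ≤-Reasoning
        ; +-0-commutativeMonoid; *-1-commutativeMonoid; ⊔-0-commutativeMonoid )
import Data.Rational.Properties as ℚ
open import Data.Product using (_,_; proj₁; proj₂)
open import Data.Sum using (_⊎_; inj₁; inj₂)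
open import Function using (_∘_; id; Equivalence)
open import Induction.WellFounded using (module All)
open import Relation.Binary.Bundles using (TotalPreorder)
import Relation.Binary.Construct.Flip.EqAndOrd as Flip
import Relation.Binary.Construct.On as On
open import Relation.Binary.PropositionalEquality
  using (_≢_; _≗_; refl; sym; trans; cong; cong₂; subst; module ≡-Reasoning)
open import Relation.Nullary using (Dec; ¬_; does; _because_; yes; no)
open import Relation.Nullary.Decidable using (dec-true; dec-false; map′; _×-dec_)
open import Relation.Nullary.Reflects using (invert)
open import Relation.Unary using (Decidable)
open import Algebra.Properties.CommutativeSemigroup
  (CommutativeMonoid.commutativeSemigroup ∧-commutativeMonoid) using (xy∙z≈xz∙y)
open import Algebra.Properties.CommutativeMonoid.Sum *-1-commutativeMonoid
  using (sum-syntax; sum-cong-≗; ∑-comm)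

does⁺ : ∀ {p} {P : Set p} (P? : Dec P) → P → T (does P?)
does⁺ (true  because _)    _ = _
does⁺ (false because [¬p]) p = ⊥-elim (invert [¬p] p)

does⁻ : ∀ {p} {P : Set p} (P? : Dec P) → T (does P?) → P
does⁻ (true because [p]) _ = invert [p]

T-not⁺ : ∀ {b} → ¬ T b → T (not b)
T-not⁺ {true}  ¬b = ¬b _
T-not⁺ {false} _  = _

T-not⁻ : ∀ {b} → T (not b) → ¬ T b
T-not⁻ {false} _ ()

measureRec : ∀ {a p} {A : Set a} (μ : A → ℕ) (P : A → Set p) →
             (∀ x → (∀ {y} → μ y < μ x → P y) → P x) → ∀ x → P x
measureRec μ P = All.wfRec (On.wellFounded μ <-wellFounded) _ P

Subset : ℕ → Set
Subset n = Fin n → Bool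

-- Membership is a record and the operations below are opaque, so that Agda can infer a
-- subset such as A - y from a membership proof instead of facing an unfolded λ-term.
module _ {n : ℕ} where

  infix  4 _∈_ _∉_ _⊆_ _∈?_
  infixl 6 _∩_ _─_ _-_

  record _∈_ (x : Fin n) (A : Subset n) : Set where
    constructor member
    field isMember : T (A x)

  open _∈_ public

  _∉_ : Fin n → Subset n → Set
  x ∉ A = ¬ x ∈ A

  _⊆_ : Subset n → Subset n → Set
  A ⊆ B = ∀ {x} → x ∈ A → x ∈ B

  Empty : Subset n → Set
  Empty A = ∀ x → x ∉ A

  _∈?_ : ∀ x A → Dec (x ∈ A)
  x ∈? A = map′ member isMember (T? (A x))

  full : Subset n
  full _ = true

  ∈-full : ∀ {x} → x ∈ full
  ∈-full = member _

  opaque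

    ⁅_⁆ : Fin n → Subset n
    ⁅ y ⁆ x = does (y ≟ x)

    _∩_ : Subset n → Subset n → Subset n
    (A ∩ B) x = A x ∧ B x

    _─_ : Subset n → Subset n → Subset n
    (A ─ B) x = A x ∧ not (B x)

  _-_ : Subset n → Fin n → Subset n
  A - y = A ─ ⁅ y ⁆

  opaque
    unfolding ⁅_⁆ _∩_ _─_

    ⁅⁆-def : ∀ y x → ⁅ y ⁆ x ≡ does (y ≟ x)
    ⁅⁆-def y x = refl

    ∩-def : ∀ A B x → (A ∩ B) x ≡ A x ∧ B x
    ∩-def A B x = refl

    ─-def : ∀ A B x → (A ─ B) x ≡ A x ∧ not (B x)
    ─-def A B x = refl

    ∈-⁅⁆⁺ : ∀ {y} → y ∈ ⁅ y ⁆
    ∈-⁅⁆⁺ {y} = member (does⁺ (y ≟ y) refl)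

    ∈-⁅⁆⁻ : ∀ {y x} → x ∈ ⁅ y ⁆ → y ≡ x
    ∈-⁅⁆⁻ {y} {x} = does⁻ (y ≟ x) ∘ isMember

    ∈-∩⁺ : ∀ {A B x} → x ∈ A → x ∈ B → x ∈ A ∩ B
    ∈-∩⁺ (member a) (member b) = member (Equivalence.from T-∧ (a , b))

    ∈-∩⁻ : ∀ {A B x} → x ∈ A ∩ B → x ∈ A × x ∈ B
    ∈-∩⁻ (member h) with Equivalence.to T-∧ h
    ... | a , b = member a , member b

    ∈-─⁺ : ∀ {A B x} → x ∈ A → x ∉ B → x ∈ A ─ B
    ∈-─⁺ (member a) x∉B = member (Equivalence.from T-∧ (a , T-not⁺ (x∉B ∘ member)))

    ∈-─⁻ : ∀ {A B x} → x ∈ A ─ B → x ∈ A × x ∉ B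
    ∈-─⁻ (member h) with Equivalence.to T-∧ h
    ... | a , ¬b = member a , T-not⁻ ¬b ∘ isMember

    ∩-identityˡ : ∀ {A} → full ∩ A ≗ A
    ∩-identityˡ x = refl

    ∩-congˡ : ∀ {A A′ B} → A ≗ A′ → A ∩ B ≗ A′ ∩ B
    ∩-congˡ {B = B} A≗A′ x = cong (_∧ B x) (A≗A′ x)

    ∩-⁅⁆ : ∀ {A y} → y ∈ A → A ∩ ⁅ y ⁆ ≗ ⁅ y ⁆
    ∩-⁅⁆ {A} {y} (member y∈A) x with y ≟ x
    ... | no _ = ∧-zeroʳ (A x)
    ∩-⁅⁆ {A} {y} (member y∈A) .y | yes refl with A y
    ... | true = refl

    ∩-remove-comm : ∀ A B y → (A ∩ B) - y ≗ (A - y) ∩ B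
    ∩-remove-comm A B y x = xy∙z≈xz∙y (A x) (B x) (not (does (y ≟ x)))

    remove-─ : ∀ A {B y} → y ∈ B → (A - y) ─ B ≗ A ─ B
    remove-─ A {B} {y} (member y∈B) x with y ≟ x
    ... | no _ = cong (_∧ not (B x)) (∧-identityʳ (A x))
    remove-─ A {B} {y} (member y∈B) .y | yes refl with A y | B y
    ... | true  | true = refl
    ... | false | true = refl

    ─-disjoint : ∀ A B → Empty (A ∩ B) → A ≗ A ─ B
    ─-disjoint A B A∩B-empty x with A x | B x | A∩B-empty x ∘ member
    ... | true  | true  | x∉A∩B = ⊥-elim (x∉A∩B _)
    ... | true  | false | _     = refl
    ... | false | _     | _     = refl

  ∈-remove⁺ : ∀ {A y x} → x ∈ A → y ≢ x → x ∈ A - y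
  ∈-remove⁺ x∈A y≢x = ∈-─⁺ x∈A (y≢x ∘ ∈-⁅⁆⁻)

  ∈-remove⁻ : ∀ {A y x} → x ∈ A - y → x ∈ A × y ≢ x
  ∈-remove⁻ x∈A-y with ∈-─⁻ x∈A-y
  ... | x∈A , x∉⁅y⁆ = x∈A , λ { refl → x∉⁅y⁆ ∈-⁅⁆⁺ }

  remove-⊆ : ∀ {A y} → A - y ⊆ A
  remove-⊆ = proj₁ ∘ ∈-remove⁻

  ∩-mono : ∀ {A A′ B B′} → A ⊆ A′ → B ⊆ B′ → A ∩ B ⊆ A′ ∩ B′
  ∩-mono A⊆A′ B⊆B′ x∈A∩B with ∈-∩⁻ x∈A∩B
  ... | x∈A , x∈B = ∈-∩⁺ (A⊆A′ x∈A) (B⊆B′ x∈B)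

  empty-or-member : ∀ A → Empty A ⊎ ∃[ y ] y ∈ A
  empty-or-member A with any? (_∈? A)
  ... | yes y∈A = inj₂ y∈A
  ... | no  ∄   = inj₁ λ x x∈A → ∄ (x , x∈A)

∈-∘suc⁺ : ∀ {n} {A : Subset (suc n)} {x} → suc x ∈ A → x ∈ A ∘ suc
∈-∘suc⁺ (member a) = member a

∈-∘suc⁻ : ∀ {n} {A : Subset (suc n)} {x} → x ∈ A ∘ suc → suc x ∈ A
∈-∘suc⁻ (member a) = member a

module _ {c ℓ₁ ℓ₂} (O : TotalPreorder c ℓ₁ ℓ₂) where

  open TotalPreorder O using (Carrier; _≲_; total) renaming (refl to ≲-refl; trans to ≲-trans)

  IsArgMax : ∀ {n} → Subset n → (Fin n → Carrier) → Fin n → Set _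
  IsArgMax A f z = z ∈ A × (∀ {x} → x ∈ A → f x ≲ f z)

  empty-or-argmax : ∀ {n} (A : Subset n) (f : Fin n → Carrier) → Empty A ⊎ ∃[ z ] IsArgMax A f z
  empty-or-argmax {zero}  A f = inj₁ λ ()
  empty-or-argmax {suc n} A f with zero ∈? A | empty-or-argmax (A ∘ suc) (f ∘ suc)
  ... | no 0∉A | inj₁ none = inj₁ λ { zero 0∈A → 0∉A 0∈A ; (suc x) x∈A → none x (∈-∘suc⁺ x∈A) }
  ... | no 0∉A | inj₂ (z , z∈A , max) = inj₂ (suc z , ∈-∘suc⁻ z∈A ,
        λ { {zero} 0∈A → ⊥-elim (0∉A 0∈A) ; {suc x} x∈A → max (∈-∘suc⁺ x∈A) })
  ... | yes 0∈A | inj₁ none = inj₂ (zero , 0∈A ,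
        λ { {zero} _ → ≲-refl ; {suc x} x∈A → ⊥-elim (none x (∈-∘suc⁺ x∈A)) })
  ... | yes 0∈A | inj₂ (z , z∈A , max) with total (f zero) (f (suc z))
  ...   | inj₁ f0≲fz = inj₂ (suc z , ∈-∘suc⁻ z∈A ,
          λ { {zero} _ → f0≲fz ; {suc x} x∈A → max (∈-∘suc⁺ x∈A) })
  ...   | inj₂ fz≲f0 = inj₂ (zero , 0∈A ,
          λ { {zero} _ → ≲-refl ; {suc x} x∈A → ≲-trans (max (∈-∘suc⁺ x∈A)) fz≲f0 })

module RestrictedSum {a ℓ} (M : CommutativeMonoid a ℓ) where

  open CommutativeMonoid M renaming (refl to ≈-refl; sym to ≈-sym; trans to ≈-trans)
  open import Algebra.Properties.CommutativeMonoid.Sum M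
    using (sum; sum-cong-≋; ∑-distrib-+; sum-replicate-zero; sum-remove)
  open import Relation.Binary.Reasoning.Setoid setoid

  ⨁[_]_ : ∀ {n} → Subset n → (Fin n → Carrier) → Carrier
  ⨁[ A ] f = sum (λ x → if A x then f x else ε)

  ⨁-cong : ∀ {n} {A B : Subset n} {f g} → A ≗ B → (∀ {x} → x ∈ A → f x ≈ g x) → ⨁[ A ] f ≈ ⨁[ B ] g
  ⨁-cong {A = A} {B} {f} {g} A≗B f≈g = sum-cong-≋ pointwise
    where
    pointwise : ∀ x → (if A x then f x else ε) ≈ (if B x then g x else ε)
    pointwise x with A x | B x | A≗B x | f≈g {x} ∘ member
    ... | true  | .true  | refl | fx≈gx = fx≈gx _
    ... | false | .false | refl | _     = ≈-refl

  ⨁-empty : ∀ {n} {A : Subset n} f → Empty A → ⨁[ A ] f ≈ ε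
  ⨁-empty {n} {A} f A-empty = ≈-trans (sum-cong-≋ pointwise) (sum-replicate-zero n)
    where
    pointwise : ∀ x → (if A x then f x else ε) ≈ ε
    pointwise x with A x | A-empty x ∘ member
    ... | true  | x∉A = ⊥-elim (x∉A _)
    ... | false | _   = ≈-refl

  ⨁-split : ∀ {n} (A B : Subset n) f → ⨁[ A ] f ≈ ⨁[ A ∩ B ] f ∙ ⨁[ A ─ B ] f
  ⨁-split A B f = ≈-trans (sum-cong-≋ pointwise) (∑-distrib-+ inside outside)
    where
    inside outside : Fin _ → Carrier
    inside  x = if (A ∩ B) x then f x else ε
    outside x = if (A ─ B) x then f x else ε
    pointwise : ∀ x → (if A x then f x else ε) ≈ inside x ∙ outside x
    pointwise x rewrite ∩-def A B x | ─-def A B x with A x | B x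
    ... | true  | true  = ≈-sym (identityʳ _)
    ... | true  | false = ≈-sym (identityˡ _)
    ... | false | _     = ≈-sym (identityˡ _)

  ⨁-⁅⁆ : ∀ {n} {y : Fin n} f → ⨁[ ⁅ y ⁆ ] f ≈ f y
  ⨁-⁅⁆ {suc n} {y} f = begin
    sum t                      ≈⟨ sum-remove {i = y} t ⟩
    t y ∙ sum (t ∘ punchIn y)  ≈⟨ ∙-cong at-y (≈-trans (sum-cong-≋ off-y) (sum-replicate-zero n)) ⟩
    f y ∙ ε                    ≈⟨ identityʳ _ ⟩
    f y                        ∎
    where
    t : Fin (suc n) → Carrier
    t x = if ⁅ y ⁆ x then f x else ε
    at-y : t y ≈ f y
    at-y rewrite ⁅⁆-def y y | dec-true (y ≟ y) refl = ≈-refl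
    off-y : ∀ j → t (punchIn y j) ≈ ε
    off-y j rewrite ⁅⁆-def y (punchIn y j) | dec-false (y ≟ punchIn y j) (punchInᵢ≢i y j ∘ sym) = ≈-refl

  ⨁-remove : ∀ {n} {A : Subset n} {y} f → y ∈ A → ⨁[ A ] f ≈ f y ∙ ⨁[ A - y ] f
  ⨁-remove {A = A} {y} f y∈A = begin
    ⨁[ A ] f                         ≈⟨ ⨁-split A ⁅ y ⁆ f ⟩
    ⨁[ A ∩ ⁅ y ⁆ ] f ∙ ⨁[ A - y ] f  ≈⟨ ∙-congʳ (⨁-cong (∩-⁅⁆ y∈A) (λ _ → ≈-refl)) ⟩
    ⨁[ ⁅ y ⁆ ] f ∙ ⨁[ A - y ] f      ≈⟨ ∙-congʳ (⨁-⁅⁆ f) ⟩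
    f y ∙ ⨁[ A - y ] f               ∎

module Count = RestrictedSum +-0-commutativeMonoid
module Prod  = RestrictedSum *-1-commutativeMonoid
module Max   = RestrictedSum ⊔-0-commutativeMonoid

open Prod using () renaming (⨁[_]_ to ∏[_]_)
open Max  using () renaming (⨁[_]_ to ⨆[_]_)

count : ∀ {n} → Subset n → ℕ
count A = Count.⨁[ A ] λ _ → 1

count-cong : ∀ {n} {A B : Subset n} → A ≗ B → count A ≡ count B
count-cong A≗B = Count.⨁-cong A≗B λ _ → refl

count-empty : ∀ {n} {A : Subset n} → Empty A → count A ≡ 0
count-empty = Count.⨁-empty _

count-remove : ∀ {n} {A : Subset n} {y} → y ∈ A → count A ≡ suc (count (A - y))
count-remove = Count.⨁-remove _

count-mono : ∀ {n} {A B : Subset n} → A ⊆ B → count A ≤ℕ count B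
count-mono {zero}          _   = z≤n
count-mono {suc n} {A} {B} A⊆B = +-mono-≤ head (count-mono (∈-∘suc⁺ ∘ A⊆B ∘ ∈-∘suc⁻))
  where
  head : (if A zero then 1 else 0) ≤ℕ (if B zero then 1 else 0)
  head with A zero | B zero | isMember ∘ A⊆B {zero} ∘ member
  ... | true  | true  | _     = ≤-refl
  ... | true  | false | 0∈B  = ⊥-elim (0∈B _)
  ... | false | _     | _     = z≤n

count-≤-remove : ∀ {n} (A : Subset n) y → count A ≤ℕ suc (count (A - y))
count-≤-remove A y with y ∈? A
... | yes y∈A = ≤-reflexive (count-remove y∈A)
... | no  y∉A = m≤n⇒m≤1+n (count-mono λ x∈A → ∈-remove⁺ x∈A λ { refl → y∉A x∈A })

∏-mono-≤ : ∀ {n} {A : Subset n} {f g : Fin n → ℕ} → (∀ {x} → x ∈ A → f x ≤ℕ g x) → ∏[ A ] f ≤ℕ ∏[ A ] g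
∏-mono-≤ {zero}              _   = ≤-refl
∏-mono-≤ {suc n} {A} {f} {g} f≤g = *-mono-≤ head (∏-mono-≤ (f≤g ∘ ∈-∘suc⁻))
  where
  head : (if A zero then f zero else 1) ≤ℕ (if A zero then g zero else 1)
  head with A zero | f≤g {zero} ∘ member
  ... | true  | f0≤g0 = f0≤g0 _
  ... | false | _     = ≤-refl

∏-const : ∀ {n} (A : Subset n) v → ∏[ A ] (λ _ → v) ≡ v ^ count A
∏-const {zero}  A v = refl
∏-const {suc n} A v with A zero
... | true  = cong (v *_) (∏-const (A ∘ suc) v)
... | false = trans (*-identityˡ _) (∏-const (A ∘ suc) v)

≤-⨆ : ∀ {n} {A : Subset n} {y} f → y ∈ A → f y ≤ℕ ⨆[ A ] f
≤-⨆ f y∈A = ≤-trans (m≤m⊔n _ _) (≤-reflexive (sym (Max.⨁-remove f y∈A)))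

⨆-lub : ∀ {n} {A : Subset n} {f : Fin n → ℕ} {b} → (∀ {x} → x ∈ A → f x ≤ℕ b) → ⨆[ A ] f ≤ℕ b
⨆-lub {zero}          _   = z≤n
⨆-lub {suc n} {A} {f} f≤b = ⊔-lub head (⨆-lub (f≤b ∘ ∈-∘suc⁻))
  where
  head : (if A zero then f zero else 0) ≤ℕ _
  head with A zero | f≤b {zero} ∘ member
  ... | true  | f0≤b = f0≤b _
  ... | false | _    = z≤n

suc*suc≤ : ∀ a q P → suc q ≤ℕ a → suc a * (suc q * P) ≤ℕ suc (suc q) * (a * P)
suc*suc≤ a q P q<a = begin
  suc a * (suc q * P)      ≡⟨ *-assoc (suc a) (suc q) P ⟨
  (suc q + a * suc q) * P  ≤⟨ *-monoˡ-≤ P (+-mono-≤ q<a (≤-reflexive (*-comm a (suc q)))) ⟩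
  suc (suc q) * a * P      ≡⟨ *-assoc (suc (suc q)) a P ⟩
  suc (suc q) * (a * P)    ∎
  where open ≤-Reasoning

-- Listed in decreasing order, the i-th value of f on Y is at least |Y| + 1 - i (apply the
-- hypothesis to the |Y| + 1 - i smallest), so ∏ (1 + 1/f x) ≤ ∏ⱼ (1 + 1/j) = |Y| + 1.
∏-suc-≤ : ∀ {n} (Y : Subset n) (f : Fin n → ℕ) →
          (∀ {Y′} → Y′ ⊆ Y → ∀ {y} → y ∈ Y′ → ∃[ x ] x ∈ Y′ × count Y′ ≤ℕ f x) →
          ∏[ Y ] (suc ∘ f) ≤ℕ suc (count Y) * ∏[ Y ] f
∏-suc-≤ {n} Y f = measureRec count Bound step Y
  where
  Bound : Subset n → Set
  Bound Y = (∀ {Y′} → Y′ ⊆ Y → ∀ {y} → y ∈ Y′ → ∃[ x ] x ∈ Y′ × count Y′ ≤ℕ f x) →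
            ∏[ Y ] (suc ∘ f) ≤ℕ suc (count Y) * ∏[ Y ] f
  step : ∀ Y → (∀ {Y′} → count Y′ < count Y → Bound Y′) → Bound Y
  step Y rec dominated with empty-or-member Y
  ... | inj₁ Y-empty = ≤-reflexive (begin-equality
    ∏[ Y ] (suc ∘ f)          ≡⟨ Prod.⨁-empty _ Y-empty ⟩
    1                         ≡⟨ cong (λ k → suc k * 1) (count-empty Y-empty) ⟨
    suc (count Y) * 1         ≡⟨ cong (suc (count Y) *_) (Prod.⨁-empty _ Y-empty) ⟨
    suc (count Y) * ∏[ Y ] f  ∎)
    where open ≤-Reasoning
  ... | inj₂ (y , y∈Y) with dominated id y∈Y
  ... | x , x∈Y , |Y|≤fx = begin
    ∏[ Y ] (suc ∘ f)                                  ≡⟨ Prod.⨁-remove _ x∈Y ⟩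
    suc (f x) * ∏[ Y - x ] (suc ∘ f)                  ≤⟨ *-monoʳ-≤ (suc (f x)) (rec smaller dominated′) ⟩
    suc (f x) * (suc (count (Y - x)) * ∏[ Y - x ] f)  ≤⟨ suc*suc≤ (f x) _ _ (subst (_≤ℕ f x) |Y|≡ |Y|≤fx) ⟩
    suc (suc (count (Y - x))) * (f x * ∏[ Y - x ] f)  ≡⟨ cong₂ (λ k P → suc k * P) |Y|≡ (Prod.⨁-remove _ x∈Y) ⟨
    suc (count Y) * ∏[ Y ] f                          ∎
    where
    open ≤-Reasoning
    |Y|≡ : count Y ≡ suc (count (Y - x))
    |Y|≡ = count-remove x∈Y
    smaller : count (Y - x) < count Y
    smaller = ≤-reflexive (sym |Y|≡)
    dominated′ : ∀ {Y′} → Y′ ⊆ Y - x → ∀ {y} → y ∈ Y′ → ∃[ x ] x ∈ Y′ × count Y′ ≤ℕ f x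
    dominated′ Y′⊆Y-x = dominated (remove-⊆ ∘ Y′⊆Y-x)

fibre : ∀ {n k} → (Fin n → Fin k) → Fin k → Subset n
fibre C i x = ⁅ C x ⁆ i

∈-fibre⁺ : ∀ {n k} {C : Fin n → Fin k} {x i} → C x ≡ i → x ∈ fibre C i
∈-fibre⁺ refl = member (isMember ∈-⁅⁆⁺)

∈-fibre⁻ : ∀ {n k} {C : Fin n → Fin k} {x i} → x ∈ fibre C i → C x ≡ i
∈-fibre⁻ (member h) = ∈-⁅⁆⁻ (member h)

∏-fibres : ∀ {n k} (C : Fin n → Fin k) (g : Fin k → ℕ) →
           ∏[ full ] (g ∘ C) ≡ ∏[ full ] (λ i → g i ^ count (fibre C i))
∏-fibres {n} {k} C g = begin
  ∏[ full ] (g ∘ C)                                      ≡⟨ sum-cong-≗ (λ x → Prod.⨁-⁅⁆ {y = C x} g) ⟨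
  ∑[ x < n ] ∑[ i < k ] (if ⁅ C x ⁆ i then g i else 1)   ≡⟨ ∑-comm (λ x i → if ⁅ C x ⁆ i then g i else 1) ⟩
  ∑[ i < k ] ∑[ x < n ] (if ⁅ C x ⁆ i then g i else 1)   ≡⟨ sum-cong-≗ (λ i → ∏-const (fibre C i) (g i)) ⟩
  ∏[ full ] (λ i → g i ^ count (fibre C i))              ∎
  where open ≡-Reasoning

-- 2^𝓔(C) for the colouring C restricted to S, as a product over intervals:
-- ∏ᵢ cᵢ^(2cᵢ) = ∏ₓ c_(C x)².
energy : ∀ {n k} → Subset n → (Fin n → Fin k) → ℕ
energy S C = ∏[ S ] λ x → count (S ∩ fibre C (C x)) * count (S ∩ fibre C (C x))

opaque

  recolour : ∀ {n k} → Subset n → Fin k → (Fin n → Fin k) → Fin n → Fin k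
  recolour K z C x = if K x then z else C x

  recolour-∈ : ∀ {n k} {K : Subset n} {z : Fin k} {C x} → x ∈ K → recolour K z C x ≡ z
  recolour-∈ {K = K} {x = x} (member x∈K) with K x
  ... | true = refl

  recolour-∉ : ∀ {n k} {K : Subset n} {z : Fin k} {C x} → x ∉ K → recolour K z C x ≡ C x
  recolour-∉ {K = K} {x = x} x∉K with K x | x∉K ∘ member
  ... | true  | x∉K′ = ⊥-elim (x∉K′ _)
  ... | false | _    = refl

square-mono : ∀ {a b} → a ≤ℕ b → a * a ≤ℕ b * b
square-mono a≤b = *-mono-≤ a≤b a≤b

energy-recolour : ∀ {n k} (S K : Subset n) (z : Fin k) (C : Fin n → Fin k) →
                  let m = count (S ∩ K) in
                  (m * m) ^ m * energy (S ─ K) C ≤ℕ energy S (recolour K z C)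
energy-recolour S K z C = begin
  (m * m) ^ m * energy (S ─ K) C               ≡⟨ cong (_* energy (S ─ K) C) (∏-const (S ∩ K) (m * m)) ⟨
  ∏[ S ∩ K ] (λ _ → m * m) * energy (S ─ K) C  ≤⟨ *-mono-≤ (∏-mono-≤ inside) (∏-mono-≤ outside) ⟩
  ∏[ S ∩ K ] class² * ∏[ S ─ K ] class²        ≡⟨ Prod.⨁-split S K class² ⟨
  energy S C*                                  ∎
  where
  open ≤-Reasoning
  m = count (S ∩ K)
  C* = recolour K z C
  class² : Fin _ → ℕ
  class² x = count (S ∩ fibre C* (C* x)) * count (S ∩ fibre C* (C* x))
  inside : ∀ {x} → x ∈ S ∩ K → m * m ≤ℕ class² x
  inside {x} x∈S∩K = square-mono (count-mono S∩K⊆class)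
    where
    S∩K⊆class : S ∩ K ⊆ S ∩ fibre C* (C* x)
    S∩K⊆class u∈S∩K with ∈-∩⁻ u∈S∩K
    ... | u∈S , u∈K = ∈-∩⁺ u∈S (∈-fibre⁺ (trans (recolour-∈ u∈K) (sym (recolour-∈ (proj₂ (∈-∩⁻ x∈S∩K))))))
  outside : ∀ {x} → x ∈ S ─ K →
            count ((S ─ K) ∩ fibre C (C x)) * count ((S ─ K) ∩ fibre C (C x)) ≤ℕ class² x
  outside {x} x∈S─K = square-mono (count-mono class⊆class)
    where
    class⊆class : (S ─ K) ∩ fibre C (C x) ⊆ S ∩ fibre C* (C* x)
    class⊆class u∈ with ∈-∩⁻ u∈
    ... | u∈S─K , u∈fibre with ∈-─⁻ u∈S─K
    ... | u∈S , u∉K = ∈-∩⁺ u∈S (∈-fibre⁺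
      (trans (recolour-∉ u∉K) (trans (∈-fibre⁻ u∈fibre) (sym (recolour-∉ (proj₂ (∈-─⁻ x∈S─K)))))))

prodFin≡∏ : ∀ n (f : Fin n → ℕ) → prodFin n f ≡ ∏[ full ] f
prodFin≡∏ zero    f = refl
prodFin≡∏ (suc n) f = cong (f zero *_) (prodFin≡∏ n (f ∘ suc))

length-filter-tabulate : ∀ {n p} {A : Set} {P : A → Set p} (P? : Decidable P) (f : Fin n → A) →
                         length (filter P? (tabulate f)) ≡ count (λ x → does (P? (f x)))
length-filter-tabulate {zero}  P? f = refl
length-filter-tabulate {suc n} P? f with does (P? (f zero))
... | true  = cong suc (length-filter-tabulate P? (f ∘ suc))
... | false = length-filter-tabulate P? (f ∘ suc)

colorCount≡count : ∀ {n k} (C : Fin n → Fin k) i → colorCount C i ≡ count (fibre C i)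
colorCount≡count C i =
  trans (length-filter-tabulate (λ j → C j ≟ i) id) (sym (count-cong (λ j → ⁅⁆-def (C j) i)))

energy-full : ∀ {n k} (C : Fin n → Fin k) →
              energy full C ≡ prodFin k (λ i → colorCount C i ^ (2 * colorCount C i))
energy-full {n} {k} C = begin
  energy full C                                       ≡⟨ Prod.⨁-cong {f = λ x → square (count (full ∩ fibre C (C x)))} (λ _ → refl) (λ {x} _ → cong square (count-cong (∩-identityˡ {A = fibre C (C x)}))) ⟩
  ∏[ full ] (λ x → square (count (fibre C (C x))))    ≡⟨ ∏-fibres C (square ∘ count ∘ fibre C) ⟩
  ∏[ full ] (λ i → square (c i) ^ c i)                ≡⟨ Prod.⨁-cong (λ _ → refl) (λ {i} _ → square-pow i) ⟩
  ∏[ full ] (λ i → colorCount C i ^ (2 * colorCount C i)) ≡⟨ prodFin≡∏ k _ ⟨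
  prodFin k (λ i → colorCount C i ^ (2 * colorCount C i)) ∎
  where
  open ≡-Reasoning
  square : ℕ → ℕ
  square m = m * m
  c : Fin k → ℕ
  c = count ∘ fibre C
  square-pow : ∀ i → square (c i) ^ c i ≡ colorCount C i ^ (2 * colorCount C i)
  square-pow i = begin
    (c i * c i) ^ c i      ≡⟨ cong (λ m → (c i * m) ^ c i) (*-identityʳ (c i)) ⟨
    (c i ^ 2) ^ c i        ≡⟨ ^-*-assoc (c i) 2 (c i) ⟩
    c i ^ (2 * c i)        ≡⟨ cong (λ m → m ^ (2 * m)) (colorCount≡count C i) ⟨
    colorCount C i ^ (2 * colorCount C i) ∎

module Intervals {n : ℕ} (ℓ r : Fin n → ℚ) (ℓ≤r : ∀ j → ℓ j ≤ r j) where

  infix 4 _∋_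

  _∋_ : Fin n → ℚ → Set
  y ∋ t = ℓ y ≤ t × t ≤ r y

  opaque

    Stab : ℚ → Subset n
    Stab t y = does ((ℓ y ℚ.≤? t) ×-dec (t ℚ.≤? r y))

    W : Fin n → ℚ → Subset n
    W x t y = does ((ℓ x ℚ.≤? ℓ y) ×-dec ((ℓ y ℚ.≤? t) ×-dec (t ℚ.≤? r y)))

    StartsIn : Fin n → Subset n
    StartsIn x z = does ((ℓ x ℚ.≤? ℓ z) ×-dec (ℓ z ℚ.≤? r x))

    ∈Stab⁺ : ∀ {y t} → y ∋ t → y ∈ Stab t
    ∈Stab⁺ {y} {t} = member ∘ does⁺ ((ℓ y ℚ.≤? t) ×-dec (t ℚ.≤? r y))

    ∈Stab⁻ : ∀ {y t} → y ∈ Stab t → y ∋ t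
    ∈Stab⁻ {y} {t} = does⁻ ((ℓ y ℚ.≤? t) ×-dec (t ℚ.≤? r y)) ∘ isMember

    ∈StartsIn⁺ : ∀ {x z} → x ∋ ℓ z → z ∈ StartsIn x
    ∈StartsIn⁺ {x} {z} = member ∘ does⁺ ((ℓ x ℚ.≤? ℓ z) ×-dec (ℓ z ℚ.≤? r x))

    ∈StartsIn⁻ : ∀ {x z} → z ∈ StartsIn x → x ∋ ℓ z
    ∈StartsIn⁻ {x} {z} = does⁻ ((ℓ x ℚ.≤? ℓ z) ×-dec (ℓ z ℚ.≤? r x)) ∘ isMember

    ∈W⁺ : ∀ {x y t} → ℓ x ≤ ℓ y → y ∋ t → y ∈ W x t
    ∈W⁺ {x} {y} {t} ℓx≤ℓy y∋t =
      member (does⁺ ((ℓ x ℚ.≤? ℓ y) ×-dec ((ℓ y ℚ.≤? t) ×-dec (t ℚ.≤? r y))) (ℓx≤ℓy , y∋t))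

    ∈W⁻ : ∀ {x y t} → y ∈ W x t → ℓ x ≤ ℓ y × y ∋ t
    ∈W⁻ {x} {y} {t} = does⁻ ((ℓ x ℚ.≤? ℓ y) ×-dec ((ℓ y ℚ.≤? t) ×-dec (t ℚ.≤? r y))) ∘ isMember

    cardW≡count : ∀ x t → cardW ℓ r x t ≡ count (W x t)
    cardW≡count x t = length-filter-tabulate (λ y → (ℓ x ℚ.≤? ℓ y) ×-dec ((ℓ y ℚ.≤? t) ×-dec (t ℚ.≤? r y))) id

  ∈Stab-left : ∀ y → y ∈ Stab (ℓ y)
  ∈Stab-left y = ∈Stab⁺ (ℚ.≤-refl , ℓ≤r y)

  W⊆Stab : ∀ {x t} → W x t ⊆ Stab t
  W⊆Stab = ∈Stab⁺ ∘ proj₂ ∘ ∈W⁻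

  W⊆StartsIn : ∀ {x z} → z ∈ StartsIn x → W x (ℓ z) ⊆ StartsIn x
  W⊆StartsIn z∈StartsIn u∈W with ∈StartsIn⁻ z∈StartsIn | ∈W⁻ u∈W
  ... | _ , ℓz≤rx | ℓx≤ℓu , ℓu≤ℓz , _ = ∈StartsIn⁺ (ℓx≤ℓu , ℚ.≤-trans ℓu≤ℓz ℓz≤rx)

  depth : Subset n → ℚ → ℕ
  depth T t = count (T ∩ Stab t)

  wAt : Subset n → Fin n → ℚ → ℕ
  wAt T x t = count (T ∩ W x t)

  -- |Wₓ| computed inside T.  It suffices to let t range over left endpoints ℓ z ∈ x:
  -- replacing t by the largest left endpoint in Wₓ,ₜ can only enlarge Wₓ,ₜ (w≤wMax).
  wMax : Subset n → Fin n → ℕ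
  wMax T x = ⨆[ StartsIn x ] λ z → wAt T x (ℓ z)

  potential : Subset n → ℕ
  potential T = ∏[ T ] wMax T

  DepthBound : Subset n → ℕ → Set
  DepthBound S c = ∀ z → depth S (ℓ z) ≤ℕ c

  depth-mono : ∀ {T S} t → T ⊆ S → depth T t ≤ℕ depth S t
  depth-mono t T⊆S = count-mono (∩-mono T⊆S id)

  wAt≤depth : ∀ T x t → wAt T x t ≤ℕ depth T t
  wAt≤depth T x t = count-mono (∩-mono id W⊆Stab)

  wAt≤wMax : ∀ T {x z} → z ∈ StartsIn x → wAt T x (ℓ z) ≤ℕ wMax T x
  wAt≤wMax T {x} = ≤-⨆ (λ z → wAt T x (ℓ z))

  wMax≤ : ∀ {S T c} → DepthBound S c → T ⊆ S → ∀ x → wMax T x ≤ℕ c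
  wMax≤ {S} {T} {c} bound T⊆S x = ⨆-lub λ {z} _ → begin
    wAt T x (ℓ z)  ≤⟨ wAt≤depth T x (ℓ z) ⟩
    depth T (ℓ z)  ≤⟨ depth-mono (ℓ z) T⊆S ⟩
    depth S (ℓ z)  ≤⟨ bound z ⟩
    c              ∎
    where open ≤-Reasoning

  wMax-remove : ∀ T y x → wMax T x ≤ℕ suc (wMax (T - y) x)
  wMax-remove T y x = ⨆-lub λ {z} z∈StartsIn → begin
    wAt T x (ℓ z)                      ≤⟨ count-≤-remove (T ∩ W x (ℓ z)) y ⟩
    suc (count ((T ∩ W x (ℓ z)) - y))  ≡⟨ cong suc (count-cong (∩-remove-comm T (W x (ℓ z)) y)) ⟩
    suc (wAt (T - y) x (ℓ z))          ≤⟨ s≤s (wAt≤wMax (T - y) z∈StartsIn) ⟩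
    suc (wMax (T - y) x)               ∎
    where open ≤-Reasoning

  wMax-remove-far : ∀ T {y x} → y ∉ StartsIn x → wMax T x ≤ℕ wMax (T - y) x
  wMax-remove-far T {y} {x} y∉StartsIn = ⨆-lub λ z∈StartsIn →
    ≤-trans (count-mono (keep z∈StartsIn)) (wAt≤wMax (T - y) z∈StartsIn)
    where
    keep : ∀ {z} → z ∈ StartsIn x → T ∩ W x (ℓ z) ⊆ (T - y) ∩ W x (ℓ z)
    keep z∈StartsIn u∈ with ∈-∩⁻ u∈
    ... | u∈T , u∈W = ∈-∩⁺ (∈-remove⁺ u∈T λ { refl → y∉StartsIn (W⊆StartsIn z∈StartsIn u∈W) }) u∈W

  potential-cong : ∀ {T T′} → T ≗ T′ → potential T ≡ potential T′
  potential-cong {T} {T′} T≗T′ = Prod.⨁-cong T≗T′ λ {x} _ →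
    Max.⨁-cong {f = λ z → wAt T x (ℓ z)} {λ z → wAt T′ x (ℓ z)} (λ _ → refl) λ _ → count-cong (∩-congˡ T≗T′)

  Near Far : Subset n → Fin n → Subset n
  Near T y = (T - y) ∩ Stab (ℓ y)
  Far  T y = (T - y) ─ Stab (ℓ y)

  depth-remove : ∀ {T y} → y ∈ T → depth T (ℓ y) ≡ suc (count (Near T y))
  depth-remove {T} {y} y∈T = begin
    depth T (ℓ y)                       ≡⟨ count-remove (∈-∩⁺ y∈T (∈Stab-left y)) ⟩
    suc (count ((T ∩ Stab (ℓ y)) - y))  ≡⟨ cong suc (count-cong (∩-remove-comm T (Stab (ℓ y)) y)) ⟩
    suc (count (Near T y))              ∎
    where open ≡-Reasoning

  -- The leftmost interval x of any Y ⊆ Near T y has all of Y in W x (ℓ y).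
  ∏-near-≤ : ∀ T y → ∏[ Near T y ] wMax T ≤ℕ suc (count (Near T y)) * ∏[ Near T y ] wMax (T - y)
  ∏-near-≤ T y =
    ≤-trans (∏-mono-≤ λ {x} _ → wMax-remove T y x) (∏-suc-≤ (Near T y) (wMax (T - y)) dominated)
    where
    dominated : ∀ {Y} → Y ⊆ Near T y → ∀ {u} → u ∈ Y → ∃[ x ] x ∈ Y × count Y ≤ℕ wMax (T - y) x
    dominated {Y} Y⊆Near u∈Y with empty-or-argmax (Flip.totalPreorder ℚ.≤-totalPreorder) Y ℓ
    ... | inj₁ Y-empty = ⊥-elim (Y-empty _ u∈Y)
    ... | inj₂ (x , x∈Y , leftmost) = x , x∈Y , ≤-trans (count-mono Y⊆W) (wAt≤wMax (T - y) y∈StartsIn)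
      where
      Y⊆W : Y ⊆ (T - y) ∩ W x (ℓ y)
      Y⊆W v∈Y with ∈-∩⁻ (Y⊆Near v∈Y)
      ... | v∈T-y , v∈Stab = ∈-∩⁺ v∈T-y (∈W⁺ (leftmost v∈Y) (∈Stab⁻ v∈Stab))
      y∈StartsIn : y ∈ StartsIn x
      y∈StartsIn = ∈StartsIn⁺ (∈Stab⁻ (proj₂ (∈-∩⁻ (Y⊆Near x∈Y))))

  ∏-far-≤ : ∀ T y → ∏[ Far T y ] wMax T ≤ℕ ∏[ Far T y ] wMax (T - y)
  ∏-far-≤ T y = ∏-mono-≤ λ x∈Far → wMax-remove-far T λ y∈StartsIn →
    proj₂ (∈-─⁻ x∈Far) (∈Stab⁺ (∈StartsIn⁻ y∈StartsIn))

  potential-remove : ∀ {S c T y} → DepthBound S c → T ⊆ S → y ∈ T →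
                     potential T ≤ℕ c * c * potential (T - y)
  potential-remove {S} {c} {T} {y} bound T⊆S y∈T = begin
    potential T                                               ≡⟨ Prod.⨁-remove (wMax T) y∈T ⟩
    wMax T y * ∏[ T - y ] wMax T                              ≡⟨ cong (wMax T y *_) (Prod.⨁-split (T - y) (Stab (ℓ y)) _) ⟩
    wMax T y * (∏[ Near T y ] wMax T * ∏[ Far T y ] wMax T)   ≤⟨ *-mono-≤ (wMax≤ bound T⊆S y) (*-mono-≤ near (∏-far-≤ T y)) ⟩
    c * (c * ∏[ Near T y ] wMax T′ * ∏[ Far T y ] wMax T′)    ≡⟨ cong (c *_) (*-assoc c _ _) ⟩
    c * (c * (∏[ Near T y ] wMax T′ * ∏[ Far T y ] wMax T′))  ≡⟨ *-assoc c c _ ⟨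
    c * c * (∏[ Near T y ] wMax T′ * ∏[ Far T y ] wMax T′)    ≡⟨ cong (c * c *_) (Prod.⨁-split T′ (Stab (ℓ y)) _) ⟨
    c * c * potential T′                                      ∎
    where
    open ≤-Reasoning
    T′ = T - y
    near : ∏[ Near T y ] wMax T ≤ℕ c * ∏[ Near T y ] wMax T′
    near = ≤-trans (∏-near-≤ T y) (*-monoˡ-≤ _ (begin
      suc (count (Near T y))  ≡⟨ depth-remove y∈T ⟨
      depth T (ℓ y)           ≤⟨ depth-mono (ℓ y) T⊆S ⟩
      depth S (ℓ y)           ≤⟨ bound y ⟩
      c                       ∎))

  potential-removeAll : ∀ {S c} → DepthBound S c → ∀ R {T} → T ⊆ S →
                        potential T ≤ℕ (c * c) ^ count (T ∩ R) * potential (T ─ R)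
  potential-removeAll {S} {c} bound R {T} = measureRec (λ T → count (T ∩ R)) Claim step T
    where
    Claim : Subset n → Set
    Claim T = T ⊆ S → potential T ≤ℕ (c * c) ^ count (T ∩ R) * potential (T ─ R)
    step : ∀ T → (∀ {T′} → count (T′ ∩ R) < count (T ∩ R) → Claim T′) → Claim T
    step T rec T⊆S with empty-or-member (T ∩ R)
    ... | inj₁ disjoint = ≤-reflexive (begin-equality
      potential T                                  ≡⟨ potential-cong (─-disjoint T R disjoint) ⟩
      potential (T ─ R)                            ≡⟨ *-identityˡ _ ⟨
      (c * c) ^ 0 * potential (T ─ R)              ≡⟨ cong (λ k → (c * c) ^ k * potential (T ─ R)) (count-empty disjoint) ⟨
      (c * c) ^ count (T ∩ R) * potential (T ─ R)  ∎)
      where open ≤-Reasoning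
    ... | inj₂ (y , y∈T∩R) = begin
      potential T                                                        ≤⟨ potential-remove bound T⊆S y∈T ⟩
      c * c * potential (T - y)                                          ≤⟨ *-monoʳ-≤ (c * c) (rec smaller (T⊆S ∘ remove-⊆)) ⟩
      c * c * ((c * c) ^ count ((T - y) ∩ R) * potential ((T - y) ─ R))  ≡⟨ *-assoc (c * c) _ _ ⟨
      (c * c) ^ suc (count ((T - y) ∩ R)) * potential ((T - y) ─ R)      ≡⟨ cong₂ (λ k P → (c * c) ^ k * P) |T∩R|≡ (potential-cong (sym ∘ remove-─ T y∈R)) ⟨
      (c * c) ^ count (T ∩ R) * potential (T ─ R)                        ∎
      where
      open ≤-Reasoning
      y∈T = proj₁ (∈-∩⁻ y∈T∩R)
      y∈R = proj₂ (∈-∩⁻ y∈T∩R)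
      |T∩R|≡ : count (T ∩ R) ≡ suc (count ((T - y) ∩ R))
      |T∩R|≡ = trans (count-remove y∈T∩R) (cong suc (count-cong (∩-remove-comm T R y)))
      smaller : count ((T - y) ∩ R) < count (T ∩ R)
      smaller = ≤-reflexive (sym |T∩R|≡)

  Anchored : Subset n → (Fin n → Fin n) → Set
  Anchored S C = ∀ {x} → x ∈ S → x ∋ ℓ (C x)

  GreedyColouring : Subset n → Set
  GreedyColouring S = ∃[ C ] Anchored S C × potential S ≤ℕ energy S C

  greedy : ∀ S → GreedyColouring S
  greedy = measureRec count GreedyColouring step
    where
    step : ∀ S → (∀ {S′} → count S′ < count S → GreedyColouring S′) → GreedyColouring S
    step S rec with empty-or-member S
    ... | inj₁ S-empty = id , (λ x∈S → ⊥-elim (S-empty _ x∈S)) ,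
                         ≤-reflexive (trans (Prod.⨁-empty _ S-empty) (sym (Prod.⨁-empty _ S-empty)))
    ... | inj₂ (s , s∈S) with empty-or-argmax ≤-totalPreorder full (λ z → depth S (ℓ z))
    ...   | inj₁ none = ⊥-elim (none s ∈-full)
    ...   | inj₂ (z , _ , deepest) = C , anchored , (begin
      potential S                      ≤⟨ potential-removeAll bound K id ⟩
      (c * c) ^ c * potential (S ─ K)  ≤⟨ *-monoʳ-≤ ((c * c) ^ c) potential≤energy′ ⟩
      (c * c) ^ c * energy (S ─ K) C′  ≤⟨ energy-recolour S K z C′ ⟩
      energy S C                       ∎)
      where
      open ≤-Reasoning
      K = Stab (ℓ z)
      c = depth S (ℓ z)
      bound : DepthBound S c
      bound z′ = deepest ∈-full
      c-pos : 0 < c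
      c-pos = begin-strict
        0                                   <⟨ s≤s z≤n ⟩
        suc (count ((S ∩ Stab (ℓ s)) - s))  ≡⟨ count-remove (∈-∩⁺ s∈S (∈Stab-left s)) ⟨
        depth S (ℓ s)                       ≤⟨ bound s ⟩
        c                                   ∎
      smaller : count (S ─ K) < count S
      smaller = ≤-trans (+-monoˡ-≤ (count (S ─ K)) c-pos) (≤-reflexive (sym (Count.⨁-split S K _)))
      IH = rec smaller
      C′ = proj₁ IH
      anchored′ = proj₁ (proj₂ IH)
      potential≤energy′ = proj₂ (proj₂ IH)
      C = recolour K z C′
      anchored : Anchored S C
      anchored {x} x∈S with x ∈? K
      ... | yes x∈K = subst (λ v → x ∋ ℓ v) (sym (recolour-∈ x∈K)) (∈Stab⁻ x∈K)
      ... | no  x∉K = subst (λ v → x ∋ ℓ v) (sym (recolour-∉ x∉K)) (anchored′ (∈-─⁺ x∈S x∉K))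

  w≤wMax : ∀ {w} → IsMaxW ℓ r w → ∀ x → w x ≤ℕ wMax full x
  w≤wMax {w} isMaxW x with proj₁ (isMaxW x)
  ... | t , x∋t , cardW≡w with empty-or-argmax ℚ.≤-totalPreorder (W x t) ℓ
  ...   | inj₁ none = ⊥-elim (none x (∈W⁺ ℚ.≤-refl x∋t))
  ...   | inj₂ (z , z∈W , rightmost) = begin
    w x               ≡⟨ cardW≡w ⟨
    cardW ℓ r x t     ≡⟨ cardW≡count x t ⟩
    count (W x t)     ≤⟨ count-mono W⊆ ⟩
    wAt full x (ℓ z)  ≤⟨ wAt≤wMax full (∈StartsIn⁺ (ℓx≤ℓz , ℚ.≤-trans ℓz≤t (proj₂ x∋t))) ⟩
    wMax full x       ∎
    where
    open ≤-Reasoning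
    ℓx≤ℓz = proj₁ (∈W⁻ z∈W)
    ℓz≤t  = proj₁ (proj₂ (∈W⁻ z∈W))
    W⊆ : W x t ⊆ full ∩ W x (ℓ z)
    W⊆ u∈W with ∈W⁻ u∈W
    ... | ℓx≤ℓu , _ , t≤ru = ∈-∩⁺ ∈-full (∈W⁺ ℓx≤ℓu (rightmost u∈W , ℚ.≤-trans ℓz≤t t≤ru))

mainTheorem12 : (n : ℕ) (ℓ r : Fin n → ℚ) →
    (∀ j → ℓ j ≤ r j) →
    Injective _≡_ _≡_ (endpoint ℓ r) →
    (w : Fin n → ℕ) → IsMaxW ℓ r w →
    ∃[ k ] ∃[ C ] (Intersecting {n} {k} ℓ r C ×
      prodFin n w ≤ℕ prodFin k (λ i → colorCount C i ^ (2 * colorCount C i)))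
-- The argument never needs the endpoints to be distinct.
mainTheorem12 n ℓ r ℓ≤r _ w isMaxW
  with C , anchored , potential≤energy ← Intervals.greedy ℓ r ℓ≤r full
  = n , C , intersecting , (begin
  prodFin n w                                              ≡⟨ prodFin≡∏ n w ⟩
  ∏[ full ] w                                              ≤⟨ ∏-mono-≤ (λ {x} _ → w≤wMax isMaxW x) ⟩
  potential full                                           ≤⟨ potential≤energy ⟩
  energy full C                                            ≡⟨ energy-full C ⟩
  prodFin n (λ i → colorCount C i ^ (2 * colorCount C i))  ∎)
  where
  open Intervals ℓ r ℓ≤r
  open ≤-Reasoning
  intersecting : Intersecting ℓ r C
  intersecting i = ℓ i , λ j Cj≡i → subst (λ v → j ∋ ℓ v) Cj≡i (anchored ∈-full)
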